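{- Let $q$ be an odd integer, $n=q^2+q+1$, $1\le t\le q$, and let $C_n(J)$, with $J\subseteq\{1,\dots,\lfloor n/2\rfloor\}$, be an $r$-regular circulant graph with $r=(q+1)t$. Suppose there is a difference set $D\subseteq\mathbb{Z}_n$ of size $q+1$ (giving a cyclic projective plane $\Pi_q$) such that the edges of the complete graph on vertex set $D$ whose lengths belong to $J$ form the union of $t$ pairwise edge-disjoint perfect matchings of this complete graph. Then \[\alpha_1(C_n(J))=tn.\]
   Context: A subset $D=\{d_0,\dots,d_q\}\subseteq\mathbb{Z}_n$ is a difference set if every nonzero $g\in\mathbb{Z}_n$ can be written uniquely as $g=d_i-d_j$ with $d_i\ne d_j$ in $D$; its translates $D+i$ ($i\in\mathbb{Z}_n$) are the lines of the cyclic projective plane on $\mathbb{Z}_n$. The length of a pair $\{x,y\}$ of distinct elements of $\mathbb{Z}_n$ is the unique $s\in\{1,\dots,\lfloor n/2\rfloor\}$ with $x-y\equiv\pm s\pmod n$. The circulant graph $C_n(J)$ has vertex set $\mathbb{Z}_n$, with $x,y$ adjacent iff the length of $\{x,y\}$ lies in $J$. A complete edge-coloring of a graph uses exactly $k$ colors such that for every pair of distinct colors there are two adjacent (sharing a vertex) edges receiving these colors; it is proper if adjacent edges receive distinct colors. The achromatic index $\alpha_1(G)$ is the largest $k$ such that $G$ has a proper complete edge-coloring with $k$ colors. -}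

module Defs where

open import Data.Nat using (ℕ; zero; suc; _+_; _*_; _∸_; _≤_; _⊓_; NonZero)
open import Data.Nat.DivMod using (_%_; _/_)
open import Data.Bool using (Bool; true; false)
open import Data.Bool.Properties using () renaming (_≟_ to _≟ᵇ_)
open import Data.Fin using (Fin; toℕ)
open import Data.Fin.Properties using () renaming (_≟_ to _≟ᶠ_)
open import Data.List using (List; length; filter)
open import Data.List.Base using (allFin)
open import Data.Product using (Σ; ∃; ∃-syntax; _×_; _,_)
open import Relation.Binary.PropositionalEquality using (_≡_; _≢_)
open import Relation.Nullary using (Dec; ¬_)
open import Relation.Nullary.Decidable using (_×-dec_; ¬?)

nOf : ℕ → ℕ
nOf q = suc (q * q + q)

-- x - y mod n, for x y < n
diff : (n : ℕ) → .{{NonZero n}} → ℕ → ℕ → ℕ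
diff n x y = (x + (n ∸ y)) % n

-- length of the pair {x,y}: the s ∈ {1..⌊n/2⌋} with x - y ≡ ±s (mod n)
len : (n : ℕ) → .{{NonZero n}} → ℕ → ℕ → ℕ
len n x y = diff n x y ⊓ (n ∸ diff n x y)

-- adjacency in the circulant graph C_n(J); J is a subset of ℕ given by its
-- characteristic function
Adj : (n : ℕ) → .{{NonZero n}} → (ℕ → Bool) → Fin n → Fin n → Set
Adj n J x y = (x ≢ y) × (J (len n (toℕ x) (toℕ y)) ≡ true)

adj? : (n : ℕ) → .{{_ : NonZero n}} → (J : ℕ → Bool) → (x y : Fin n) → Dec (Adj n J x y)
adj? n J x y = ¬? (x ≟ᶠ y) ×-dec (J (len n (toℕ x) (toℕ y)) ≟ᵇ true)

degree : (n : ℕ) → .{{NonZero n}} → (ℕ → Bool) → Fin n → ℕ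
degree n J x = length (filter (adj? n J x) (allFin n))

-- D = {d_0,...,d_q} ⊆ ℤ_n (d injective, so |D| = m) is a difference set:
-- every nonzero g is uniquely d_i - d_j with d_i ≠ d_j
IsDifferenceSet : (n : ℕ) → .{{NonZero n}} → (m : ℕ) → (Fin m → Fin n) → Set
IsDifferenceSet n m d =
  (∀ i j → d i ≡ d j → i ≡ j) ×
  (∀ (g : Fin n) → toℕ g ≢ 0 →
     Σ (Fin m × Fin m) λ { (i , j) →
        (d i ≢ d j) × (diff n (toℕ (d i)) (toℕ (d j)) ≡ toℕ g) ×
        (∀ i' j' → d i' ≢ d j' → diff n (toℕ (d i')) (toℕ (d j')) ≡ toℕ g →
           (d i' ≡ d i) × (d j' ≡ d j)) })

-- a perfect matching of the complete graph on Fin m, given as a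
-- fixed-point-free involution (i is matched with M i)
IsPerfectMatching : (m : ℕ) → (Fin m → Fin m) → Set
IsPerfectMatching m M = ∀ i → (M i ≢ i) × (M (M i) ≡ i)

-- a proper complete edge-colouring of C_n(J) using exactly k colours.
-- Colours are assigned to ordered pairs, required symmetric on edges; values on
-- non-edges are irrelevant.
record ProperCompleteColoring (n : ℕ) .{{_ : NonZero n}} (J : ℕ → Bool) (k : ℕ) : Set where
  field
    col      : Fin n → Fin n → Fin k
    symm     : ∀ x y → Adj n J x y → col x y ≡ col y x
    surj     : ∀ (a : Fin k) → ∃[ x ] ∃[ y ] (Adj n J x y × col x y ≡ a)
    proper   : ∀ x y z → Adj n J x y → Adj n J x z → y ≢ z → col x y ≢ col x z
    complete : ∀ (a b : Fin k) → a ≢ b →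
                 ∃[ x ] ∃[ y ] ∃[ z ] (Adj n J x y × Adj n J x z × y ≢ z × col x y ≡ a × col x z ≡ b)

AchromaticIndexIs : (n : ℕ) → .{{NonZero n}} → (ℕ → Bool) → ℕ → Set
AchromaticIndexIs n J m =
  ProperCompleteColoring n J m × (∀ k → ProperCompleteColoring n J k → k ≤ m)

module Submission where

-- Upper bound: in a complete colouring every colour b occurs at the tail of some arc of any given
-- colour a, so k ≤ r · #(a-coloured arcs).  The n r arcs are shared among the k colours: if
-- some colour has at most q arcs then k ≤ q r ≤ t n, and otherwise k (q + 1) ≤ n r = (q + 1) t n.
-- Lower bound: since D is a difference set, every edge {x, y} is, in exactly one way, the translate
-- by some s of a chord {d i, d j} of the base line D, and that chord lies in exactly one matching
-- M k; colour the edge (k, s).  Two edges at x of equal colour are translates of chords of one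
-- matching through the same point of D, hence equal.  The colours (k, s) and (k′, s′) with s ≠ s′
-- meet at the unique common point of the lines D + s and D + s′; for s = s′ any point of D + s works,
-- because distinct matchings pair it with distinct partners.

open import Defs
open import Data.Nat using (ℕ; zero; suc; _+_; _*_; _∸_; _≤_; _<_; _⊓_; _≤?_; z≤n; NonZero)
open import Data.Nat.DivMod using (_%_; _/_; _mod_; %-distribˡ-+; m%n%n≡m%n; [m+n]%n≡m%n; m<n⇒m%n≡m; m%n<n; m%n≤n)
open import Data.Nat.Properties
  using ( +-comm; +-assoc; +-identityʳ; m+[n∸m]≡n; m∸n+n≡m; m≤m+n; +-mono-≤; *-monoˡ-≤; *-cancelʳ-≤
        ; ≤-trans; ≤-reflexive; ≰⇒>; <⇒≤pred; +-commutativeSemigroup; +-0-commutativeMonoid )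
open import Data.Nat.Tactic.RingSolver using (solve-∀)
open import Algebra.Properties.CommutativeSemigroup +-commutativeSemigroup using (xy∙z≈xz∙y; xy∙z≈x∙zy)
open import Algebra.Properties.CommutativeMonoid.Sum +-0-commutativeMonoid
  using (sum-syntax; sum-cong-≗; ∑-distrib-+; sum-replicate-zero)
open import Data.Bool using (Bool; true; false; if_then_else_)
open import Data.Fin using (Fin; zero; suc; toℕ; fromℕ<; combine)
open import Data.Fin.Properties
  using ( toℕ-injective; toℕ-fromℕ<; toℕ<n; toℕ≤n; injective⇒≤; all?; ¬∀⟶∃¬
        ; combine-injectiveˡ; combine-injectiveʳ; combine-surjective )
  renaming (_≟_ to _≟ᶠ_)
open import Data.List using (List; []; _∷_; length; filter; map; concatMap; allFin; lookup)
open import Data.List.Properties using (length-map; length-++; length-tabulate)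
open import Data.List.Membership.Propositional using (_∈_; lose)
open import Data.List.Membership.Propositional.Properties using (∈-map⁺; ∈-filter⁺; ∈-concatMap⁺; ∈-allFin)
open import Data.List.Relation.Unary.Any using (index)
open import Data.List.Relation.Unary.Any.Properties using (lookup-index)
open import Data.Product using (Σ; ∃-syntax; _×_; _,_; proj₁; proj₂)
open import Data.Sum using (_⊎_; inj₁; inj₂)
open import Data.Empty using (⊥-elim)
open import Function using (_∘_)
open import Function.Bundles using (_⇔_; Equivalence)
open import Level using (0ℓ)
open import Relation.Binary.Bundles using (Setoid)
open import Relation.Binary.Structures using (IsEquivalence)
open import Relation.Binary.PropositionalEquality
open import Relation.Nullary using (Dec; yes; no; does)
import Relation.Binary.Reasoning.Setoid as SetoidReasoning

module Congruence (n : ℕ) .{{_ : NonZero n}} where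

  infix 4 _≈_

  -- A record rather than a synonym for a % n ≡ b % n, so that a and b can be inferred.
  record _≈_ (a b : ℕ) : Set where
    constructor mk≈
    field %-≡ : a % n ≡ b % n

  ≈-isEquivalence : IsEquivalence _≈_
  ≈-isEquivalence = record
    { refl  = mk≈ refl
    ; sym   = λ (mk≈ e) → mk≈ (sym e)
    ; trans = λ (mk≈ e) (mk≈ f) → mk≈ (trans e f)
    }

  ≈-setoid : Setoid 0ℓ 0ℓ
  ≈-setoid = record { isEquivalence = ≈-isEquivalence }

  open IsEquivalence ≈-isEquivalence public
    using () renaming (sym to ≈-sym; trans to ≈-trans; reflexive to ≈-reflexive)

  module ≈-Reasoning = SetoidReasoning ≈-setoid

  %-≈ : ∀ a → a % n ≈ a
  %-≈ a = mk≈ (m%n%n≡m%n a n)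

  +n-≈ : ∀ a → a + n ≈ a
  +n-≈ a = mk≈ ([m+n]%n≡m%n a n)

  +-congʳ : ∀ {a b} c → a ≈ b → a + c ≈ b + c
  +-congʳ {a} {b} c (mk≈ e) = mk≈ (begin
    (a + c) % n         ≡⟨ %-distribˡ-+ a c n ⟩
    (a % n + c % n) % n ≡⟨ cong (λ u → (u + c % n) % n) e ⟩
    (b % n + c % n) % n ≡⟨ %-distribˡ-+ b c n ⟨
    (b + c) % n         ∎)
    where open ≡-Reasoning

  +-congˡ : ∀ {a b} c → a ≈ b → c + a ≈ c + b
  +-congˡ {a} {b} c e = begin
    c + a ≡⟨ +-comm c a ⟩
    a + c ≈⟨ +-congʳ c e ⟩
    b + c ≡⟨ +-comm b c ⟩
    c + b ∎
    where open ≈-Reasoning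

  +-cancelʳ : ∀ {a b} c → a + c ≈ b + c → a ≈ b
  +-cancelʳ {a} {b} c e = begin
    a             ≈⟨ complement a ⟨
    a + c + c⁻    ≈⟨ +-congʳ c⁻ e ⟩
    b + c + c⁻    ≈⟨ complement b ⟩
    b             ∎
    where
    open ≈-Reasoning
    c⁻ = n ∸ c % n
    complement : ∀ x → x + c + c⁻ ≈ x
    complement x = begin
      x + c + c⁻       ≈⟨ +-congʳ c⁻ (+-congˡ x (%-≈ c)) ⟨
      x + c % n + c⁻   ≡⟨ +-assoc x (c % n) c⁻ ⟩
      x + (c % n + c⁻) ≡⟨ cong (x +_) (m+[n∸m]≡n (m%n≤n c n)) ⟩
      x + n            ≈⟨ +n-≈ x ⟩
      x                ∎

  +-cancelˡ : ∀ {a b} c → c + a ≈ c + b → a ≈ b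
  +-cancelˡ {a} {b} c e = +-cancelʳ c (begin
    a + c ≡⟨ +-comm a c ⟩
    c + a ≈⟨ e ⟩
    c + b ≡⟨ +-comm c b ⟩
    b + c ∎)
    where open ≈-Reasoning

  ≈⇒≡ : ∀ {a b} → a < n → b < n → a ≈ b → a ≡ b
  ≈⇒≡ {a} {b} a<n b<n (mk≈ e) = trans (sym (m<n⇒m%n≡m a<n)) (trans e (m<n⇒m%n≡m b<n))

  toℕ-≈-injective : ∀ {x y : Fin n} → toℕ x ≈ toℕ y → x ≡ y
  toℕ-≈-injective e = toℕ-injective (≈⇒≡ (toℕ<n _) (toℕ<n _) e)

  toℕ-mod : ∀ a → toℕ (a mod n) ≈ a
  toℕ-mod a = ≈-trans (≈-reflexive (toℕ-fromℕ< _)) (%-≈ a)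

  diff-< : ∀ a b → diff n a b < n
  diff-< a b = m%n<n (a + (n ∸ b)) n

  diff-+ : ∀ a (y : Fin n) → diff n a (toℕ y) + toℕ y ≈ a
  diff-+ a y = begin
    (a + (n ∸ toℕ y)) % n + toℕ y ≈⟨ +-congʳ (toℕ y) (%-≈ _) ⟩
    a + (n ∸ toℕ y) + toℕ y       ≡⟨ +-assoc a (n ∸ toℕ y) (toℕ y) ⟩
    a + (n ∸ toℕ y + toℕ y)       ≡⟨ cong (a +_) (m∸n+n≡m (toℕ≤n y)) ⟩
    a + n                         ≈⟨ +n-≈ a ⟩
    a                             ∎
    where open ≈-Reasoning

  diff≡⇒≈ : ∀ {a c} (y : Fin n) → diff n a (toℕ y) ≡ c → a ≈ toℕ y + c
  diff≡⇒≈ {a} {c} y e = begin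
    a                      ≈⟨ diff-+ a y ⟨
    diff n a (toℕ y) + toℕ y ≡⟨ cong (_+ toℕ y) e ⟩
    c + toℕ y              ≡⟨ +-comm c (toℕ y) ⟩
    toℕ y + c              ∎
    where open ≈-Reasoning

  ≈⇒diff≡ : ∀ {a c} (y : Fin n) → c < n → a ≈ toℕ y + c → diff n a (toℕ y) ≡ c
  ≈⇒diff≡ {a} {c} y c<n e = ≈⇒≡ (diff-< a (toℕ y)) c<n (+-cancelʳ (toℕ y) (begin
    diff n a (toℕ y) + toℕ y ≈⟨ diff-+ a y ⟩
    a                        ≈⟨ e ⟩
    toℕ y + c                ≡⟨ +-comm (toℕ y) c ⟩
    c + toℕ y                ∎))
    where open ≈-Reasoning

  diff-translate : ∀ {x a s} (y b : Fin n) → x ≈ a + s → toℕ y ≈ toℕ b + s →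
                   diff n x (toℕ y) ≡ diff n a (toℕ b)
  diff-translate {x} {a} {s} y b x≈ y≈ = ≈⇒diff≡ y (diff-< a (toℕ b)) (begin
    x             ≈⟨ x≈ ⟩
    a + s         ≈⟨ +-congʳ s (diff≡⇒≈ b refl) ⟩
    toℕ b + g + s ≡⟨ xy∙z≈xz∙y (toℕ b) g s ⟩
    toℕ b + s + g ≈⟨ +-congʳ g y≈ ⟨
    toℕ y + g     ∎)
    where
    open ≈-Reasoning
    g = diff n a (toℕ b)

  diff≡⇒translate : ∀ {x a s} (y b : Fin n) → diff n x (toℕ y) ≡ diff n a (toℕ b) →
                    x ≈ a + s → toℕ y ≈ toℕ b + s
  diff≡⇒translate {x} {a} {s} y b e x≈ = +-cancelʳ g (begin
    toℕ y + g     ≈⟨ diff≡⇒≈ y e ⟨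
    x             ≈⟨ x≈ ⟩
    a + s         ≈⟨ +-congʳ s (diff≡⇒≈ b refl) ⟩
    toℕ b + g + s ≡⟨ xy∙z≈xz∙y (toℕ b) g s ⟩
    toℕ b + s + g ∎)
    where
    open ≈-Reasoning
    g = diff n a (toℕ b)

  difference : Fin n → Fin n → Fin n
  difference x y = (toℕ x + (n ∸ toℕ y)) mod n

  toℕ-difference : ∀ x y → toℕ (difference x y) ≡ diff n (toℕ x) (toℕ y)
  toℕ-difference x y = toℕ-fromℕ< _

  difference-≢0 : ∀ {x y} → x ≢ y → toℕ (difference x y) ≢ 0
  difference-≢0 {x} {y} x≢y e = x≢y (toℕ-≈-injective (begin
    toℕ x     ≈⟨ diff≡⇒≈ y (trans (sym (toℕ-difference x y)) e) ⟩
    toℕ y + 0 ≡⟨ +-identityʳ (toℕ y) ⟩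
    toℕ y     ∎))
    where open ≈-Reasoning

  diff≡⇒+≈ : ∀ {a c} (b s : Fin n) → diff n a (toℕ b) ≡ diff n c (toℕ s) → a + toℕ s ≈ toℕ b + c
  diff≡⇒+≈ {a} {c} b s e = begin
    a + toℕ s             ≈⟨ +-congʳ (toℕ s) (diff≡⇒≈ b e) ⟩
    toℕ b + g + toℕ s     ≡⟨ xy∙z≈x∙zy (toℕ b) g (toℕ s) ⟩
    toℕ b + (toℕ s + g)   ≈⟨ +-congˡ (toℕ b) (diff≡⇒≈ s refl) ⟨
    toℕ b + c             ∎
    where
    open ≈-Reasoning
    g = diff n c (toℕ s)

  +≈⇒diff≡ : ∀ {a c} (b s : Fin n) → a + toℕ s ≈ toℕ b + c → diff n a (toℕ b) ≡ diff n c (toℕ s)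
  +≈⇒diff≡ {a} {c} b s e = ≈⇒diff≡ b (diff-< c (toℕ s)) (+-cancelʳ (toℕ s) (begin
    a + toℕ s             ≈⟨ e ⟩
    toℕ b + c             ≈⟨ +-congˡ (toℕ b) (diff≡⇒≈ s refl) ⟩
    toℕ b + (toℕ s + g)   ≡⟨ xy∙z≈x∙zy (toℕ b) g (toℕ s) ⟨
    toℕ b + g + toℕ s     ∎))
    where
    open ≈-Reasoning
    g = diff n c (toℕ s)

k*c≤∑ : ∀ {k} c (f : Fin k → ℕ) → (∀ a → c ≤ f a) → k * c ≤ ∑[ a < k ] f a
k*c≤∑ {zero}  c f c≤f = z≤n
k*c≤∑ {suc k} c f c≤f = +-mono-≤ (c≤f zero) (k*c≤∑ c (λ a → f (suc a)) (λ a → c≤f (suc a)))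

δ : ∀ {k} → Fin k → Fin k → ℕ
δ a b = if does (a ≟ᶠ b) then 1 else 0

∑-δ : ∀ {k} (a : Fin k) → ∑[ b < k ] δ a b ≡ 1
∑-δ {suc k} zero    = cong suc (sum-replicate-zero k)
∑-δ {suc k} (suc a) = ∑-δ a

module _ {A : Set} {k : ℕ} (f : A → Fin k) where

  fibre : Fin k → List A → List A
  fibre a = filter (λ x → f x ≟ᶠ a)

  length-fibre-∷ : ∀ a x xs → length (fibre a (x ∷ xs)) ≡ δ (f x) a + length (fibre a xs)
  length-fibre-∷ a x xs with does (f x ≟ᶠ a)
  ... | true  = refl
  ... | false = refl

  ∑-length-fibre : ∀ xs → ∑[ a < k ] length (fibre a xs) ≡ length xs
  ∑-length-fibre []       = sum-replicate-zero k
  ∑-length-fibre (x ∷ xs) = begin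
    ∑[ a < k ] length (fibre a (x ∷ xs))                     ≡⟨ sum-cong-≗ (λ a → length-fibre-∷ a x xs) ⟩
    ∑[ a < k ] (δ (f x) a + length (fibre a xs))             ≡⟨ ∑-distrib-+ (δ (f x)) (λ a → length (fibre a xs)) ⟩
    ∑[ a < k ] δ (f x) a + ∑[ a < k ] length (fibre a xs)    ≡⟨ cong₂ _+_ (∑-δ (f x)) (∑-length-fibre xs) ⟩
    suc (length xs)                                          ∎
    where open ≡-Reasoning

length-concatMap : ∀ {A B : Set} (g : A → List B) {r} → (∀ x → length (g x) ≡ r) →
                   ∀ xs → length (concatMap g xs) ≡ length xs * r
length-concatMap g len-g []       = refl
length-concatMap g len-g (x ∷ xs) = trans (length-++ (g x)) (cong₂ _+_ (len-g x) (length-concatMap g len-g xs))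

complete⇒≤length : ∀ {k} (xs : List (Fin k)) → (∀ a → a ∈ xs) → k ≤ length xs
complete⇒≤length xs a∈xs = injective⇒≤ {f = λ a → index (a∈xs a)} λ {a} {b} e → begin
  a                          ≡⟨ lookup-index (a∈xs a) ⟩
  lookup xs (index (a∈xs a)) ≡⟨ cong (lookup xs) e ⟩
  lookup xs (index (a∈xs b)) ≡⟨ lookup-index (a∈xs b) ⟨
  b                          ∎
  where open ≡-Reasoning

module ColourCounting
  {N : ℕ} {_∼_ : Fin N → Fin N → Set} (_∼?_ : ∀ x y → Dec (x ∼ y))
  {r : ℕ} (regular : ∀ x → length (filter (x ∼?_) (allFin N)) ≡ r)
  {k : ℕ} (col : Fin N → Fin N → Fin k)
  (meet : ∀ a b → ∃[ x ] ∃[ y ] ∃[ z ] (x ∼ y × x ∼ z × col x y ≡ a × col x z ≡ b))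
  where

  neighbours : Fin N → List (Fin N)
  neighbours x = filter (x ∼?_) (allFin N)

  ∈-neighbours : ∀ {x y} → x ∼ y → y ∈ neighbours x
  ∈-neighbours x∼y = ∈-filter⁺ (_ ∼?_) (∈-allFin _) x∼y

  length-map-neighbours : ∀ {B : Set} (f : Fin N → B) x → length (map f (neighbours x)) ≡ r
  length-map-neighbours f x = trans (length-map f (neighbours x)) (regular x)

  arcs : List (Fin N × Fin N)
  arcs = concatMap (λ x → map (x ,_) (neighbours x)) (allFin N)

  arcsOf : Fin k → List (Fin N × Fin N)
  arcsOf a = fibre (λ (x , y) → col x y) a arcs

  ∑-length-arcsOf : ∑[ a < k ] length (arcsOf a) ≡ N * r
  ∑-length-arcsOf = begin
    ∑[ a < k ] length (arcsOf a) ≡⟨ ∑-length-fibre (λ (x , y) → col x y) arcs ⟩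
    length arcs                  ≡⟨ length-concatMap _ (λ x → length-map-neighbours (x ,_) x) (allFin N) ⟩
    length (allFin N) * r        ≡⟨ cong (_* r) (length-tabulate {n = N} (λ x → x)) ⟩
    N * r                        ∎
    where open ≡-Reasoning

  coloursNear : Fin k → List (Fin k)
  coloursNear a = concatMap (λ (x , _) → map (col x) (neighbours x)) (arcsOf a)

  ∈-coloursNear : ∀ a b → b ∈ coloursNear a
  ∈-coloursNear a b with meet a b
  ... | x , y , z , x∼y , x∼z , refl , refl =
    ∈-concatMap⁺ _ (lose xy∈arcsOf-a (∈-map⁺ (col x) (∈-neighbours x∼z)))
    where
    xy∈arcsOf-a : (x , y) ∈ arcsOf (col x y)
    xy∈arcsOf-a = ∈-filter⁺ _ (∈-concatMap⁺ _ (lose (∈-allFin x) (∈-map⁺ (x ,_) (∈-neighbours x∼y)))) refl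

  ≤length-arcsOf*r : ∀ a → k ≤ length (arcsOf a) * r
  ≤length-arcsOf*r a = ≤-trans (complete⇒≤length (coloursNear a) (∈-coloursNear a))
    (≤-reflexive (length-concatMap _ (λ (x , _) → length-map-neighbours (col x) x) (arcsOf a)))

  colours-bound : ∀ c → k * suc c ≤ N * r ⊎ k ≤ c * r
  colours-bound c with all? (λ a → suc c ≤? length (arcsOf a))
  ... | yes large = inj₁ (≤-trans (k*c≤∑ (suc c) _ large) (≤-reflexive ∑-length-arcsOf))
  ... | no ¬large with ¬∀⟶∃¬ k _ (λ a → suc c ≤? length (arcsOf a)) ¬large
  ...   | a , ¬large-a = inj₂ (≤-trans (≤length-arcsOf*r a) (*-monoˡ-≤ r (<⇒≤pred (≰⇒> ¬large-a))))

module TranslateColouring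
  {n : ℕ} .{{_ : NonZero n}} (J : ℕ → Bool)
  {q : ℕ} (d : Fin (suc q) → Fin n) (difference-set : IsDifferenceSet n (suc q) d)
  {t : ℕ} (M : Fin t → Fin (suc q) → Fin (suc q))
  (perfect : ∀ k → IsPerfectMatching (suc q) (M k))
  (disjoint : ∀ k l → k ≢ l → ∀ i → M k i ≢ M l i)
  (J-matched : ∀ i j → i ≢ j → ((J (len n (toℕ (d i)) (toℕ (d j))) ≡ true) ⇔ (∃[ k ] M k i ≡ j)))
  (k₀ : Fin t)
  where

  open Congruence n

  D : Fin (suc q) → ℕ
  D i = toℕ (d i)

  d-injective : ∀ {i j} → d i ≡ d j → i ≡ j
  d-injective = proj₁ difference-set _ _

  D-cancelʳ : ∀ {i j} s → D i + s ≈ D j + s → i ≡ j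
  D-cancelʳ s e = d-injective (toℕ-≈-injective (+-cancelʳ s e))

  differences-unique : ∀ {i j i′ j′} → i ≢ j → i′ ≢ j′ → diff n (D i) (D j) ≡ diff n (D i′) (D j′) →
                       i ≡ i′ × j ≡ j′
  differences-unique {i} {j} {i′} {j′} i≢j i′≢j′ e
    with proj₂ difference-set (difference (d i′) (d j′)) (difference-≢0 (i′≢j′ ∘ d-injective))
  ... | (a , b) , _ , _ , unique =
    d-injective (trans (proj₁ u) (sym (proj₁ u′))) , d-injective (trans (proj₂ u) (sym (proj₂ u′)))
    where
    g≡ = toℕ-difference (d i′) (d j′)
    u  = unique i j (i≢j ∘ d-injective) (trans e (sym g≡))
    u′ = unique i′ j′ (i′≢j′ ∘ d-injective) (sym g≡)

  matched⇒≢ : ∀ {k i j} → M k i ≡ j → i ≢ j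
  matched⇒≢ {k} refl e = proj₁ (perfect k _) (sym (cong (M k) e))

  diff≡⇒len≡ : ∀ a b a′ b′ → diff n a b ≡ diff n a′ b′ → len n a b ≡ len n a′ b′
  diff≡⇒len≡ _ _ _ _ = cong (λ g → g ⊓ (n ∸ g))

  record Translate (x y : Fin n) : Set where
    constructor translate
    field
      {i j}   : Fin (suc q)
      shift   : Fin n
      class   : Fin t
      x≈      : toℕ x ≈ D i + toℕ shift
      y≈      : toℕ y ≈ D j + toℕ shift
      matched : M class i ≡ j

  open Translate using (class; shift)

  Translate-sym : ∀ {x y} → Translate x y → Translate y x
  Translate-sym (translate {i} s k x≈ y≈ m) =
    translate s k y≈ x≈ (trans (cong (M k) (sym m)) (proj₂ (perfect k i)))

  Translate⇒Adj : ∀ {x y} → Translate x y → Adj n J x y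
  Translate⇒Adj {x} {y} (translate {i} {j} s k x≈ y≈ m) = x≢y , J-true
    where
    x≢y : x ≢ y
    x≢y refl = matched⇒≢ m (D-cancelʳ (toℕ s) (≈-trans (≈-sym x≈) y≈))
    J-true : J (len n (toℕ x) (toℕ y)) ≡ true
    J-true = trans (cong J (diff≡⇒len≡ (toℕ x) (toℕ y) (D i) (D j) (diff-translate y (d j) x≈ y≈)))
                   (Equivalence.from (J-matched i j (matched⇒≢ m)) (k , m))

  Adj⇒Translate : ∀ {x y} → Adj n J x y → Translate x y
  Adj⇒Translate {x} {y} (x≢y , J-true)
    with proj₂ difference-set (difference x y) (difference-≢0 x≢y)
  ... | (i , j) , di≢dj , Dij≡g , _ = translate s k x≈ y≈ m
    where
    s  = difference x (d i)
    x≈ : toℕ x ≈ D i + toℕ s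
    x≈ = diff≡⇒≈ (d i) (sym (toℕ-difference x (d i)))
    Dij≡xy : diff n (D i) (D j) ≡ diff n (toℕ x) (toℕ y)
    Dij≡xy = trans Dij≡g (toℕ-difference x y)
    y≈ : toℕ y ≈ D j + toℕ s
    y≈ = diff≡⇒translate y (d j) (sym Dij≡xy) x≈
    km : ∃[ k ] M k i ≡ j
    km = Equivalence.to (J-matched i j (di≢dj ∘ cong d))
           (trans (cong J (diff≡⇒len≡ (D i) (D j) (toℕ x) (toℕ y) Dij≡xy)) J-true)
    k = proj₁ km
    m = proj₂ km

  Translate-unique : ∀ {x y} (T T′ : Translate x y) → class T ≡ class T′ × shift T ≡ shift T′
  Translate-unique {x} {y} (translate {i} {j} s k x≈ y≈ m) (translate {i′} {j′} s′ k′ x≈′ y≈′ m′)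
    with differences-unique (matched⇒≢ m) (matched⇒≢ m′)
           (trans (sym (diff-translate y (d j) x≈ y≈)) (diff-translate y (d j′) x≈′ y≈′))
  ... | refl , refl = same-class , toℕ-≈-injective (+-cancelˡ (D i) (≈-trans (≈-sym x≈) x≈′))
    where
    same-class : k ≡ k′
    same-class with k ≟ᶠ k′
    ... | yes k≡k′ = k≡k′
    ... | no k≢k′  = ⊥-elim (disjoint k k′ k≢k′ i (trans m (sym m′)))

  Translate-functional : ∀ {x y z} (T : Translate x y) (T′ : Translate x z) →
                         class T ≡ class T′ → shift T ≡ shift T′ → y ≡ z
  Translate-functional (translate {i} s k x≈ y≈ refl) (translate {i′} .s .k x≈′ z≈ refl) refl refl
    with D-cancelʳ (toℕ s) (≈-trans (≈-sym x≈) x≈′)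
  ... | refl = toℕ-≈-injective (≈-trans y≈ (≈-sym z≈))

  colourOf : ∀ {x y} → Translate x y → Fin (t * n)
  colourOf T = combine (class T) (shift T)

  colour : Fin n → Fin n → Fin (t * n)
  colour x y with adj? n J x y
  ... | yes x∼y = colourOf (Adj⇒Translate x∼y)
  ... | no _    = combine k₀ x

  colour-Translate : ∀ {x y} (T : Translate x y) → colour x y ≡ colourOf T
  colour-Translate {x} {y} T with adj? n J x y
  ... | yes x∼y = cong₂ combine (proj₁ same) (proj₂ same)
    where same = Translate-unique (Adj⇒Translate x∼y) T
  ... | no ¬x∼y = ⊥-elim (¬x∼y (Translate⇒Adj T))

  point : Fin (suc q) → Fin n → Fin n
  point i s = (D i + toℕ s) mod n

  chord : ∀ k i s → Translate (point i s) (point (M k i) s)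
  chord k i s = translate s k (toℕ-mod _) (toℕ-mod _) refl

  colour-symm : ∀ x y → Adj n J x y → colour x y ≡ colour y x
  colour-symm x y x∼y = trans (colour-Translate T) (sym (colour-Translate (Translate-sym T)))
    where T = Adj⇒Translate x∼y

  colour-proper : ∀ x y z → Adj n J x y → Adj n J x z → y ≢ z → colour x y ≢ colour x z
  colour-proper x y z x∼y x∼z y≢z e = y≢z (Translate-functional T T′
      (combine-injectiveˡ (class T) (shift T) (class T′) (shift T′) e′)
      (combine-injectiveʳ (class T) (shift T) (class T′) (shift T′) e′))
    where
    T  = Adj⇒Translate x∼y
    T′ = Adj⇒Translate x∼z
    e′ = trans (sym (colour-Translate T)) (trans e (colour-Translate T′))

  colour-surjective : ∀ a → ∃[ x ] ∃[ y ] (Adj n J x y × colour x y ≡ a)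
  colour-surjective a with combine-surjective {t} a
  ... | k , s , refl = _ , _ , Translate⇒Adj (chord k zero s) , colour-Translate (chord k zero s)

  point-≡⇒≈ : ∀ {i j s s′} → point i s ≡ point j s′ → D i + toℕ s ≈ D j + toℕ s′
  point-≡⇒≈ e = ≈-trans (≈-sym (toℕ-mod _)) (≈-trans (≈-reflexive (cong toℕ e)) (toℕ-mod _))

  ColoursMeet : Fin (t * n) → Fin (t * n) → Set
  ColoursMeet a b = ∃[ x ] ∃[ y ] ∃[ z ] (Adj n J x y × Adj n J x z × y ≢ z × colour x y ≡ a × colour x z ≡ b)

  meet-same-shift : ∀ {k k′} s → k ≢ k′ → ColoursMeet (combine k s) (combine k′ s)
  meet-same-shift {k} {k′} s k≢k′ =
    _ , _ , _ , Translate⇒Adj T , Translate⇒Adj T′ , y≢z , colour-Translate T , colour-Translate T′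
    where
    T  = chord k zero s
    T′ = chord k′ zero s
    y≢z : point (M k zero) s ≢ point (M k′ zero) s
    y≢z e = disjoint k k′ k≢k′ zero (D-cancelʳ (toℕ s) (point-≡⇒≈ e))

  -- The lines D + s and D + s′ meet in x = d i + s = d i′ + s′, where d i − d i′ = s′ − s.
  meet-other-shift : ∀ k k′ {s s′} → s ≢ s′ → ColoursMeet (combine k s) (combine k′ s′)
  meet-other-shift k k′ {s} {s′} s≢s′
    with proj₂ difference-set (difference s′ s) (difference-≢0 (s≢s′ ∘ sym))
  ... | (i , i′) , di≢di′ , Dii′≡g , _ =
    _ , _ , _ , Translate⇒Adj T , Translate⇒Adj T′ , y≢z , colour-Translate T , colour-Translate T′
    where
    Dii′≡ss′ : diff n (D i) (D i′) ≡ diff n (toℕ s′) (toℕ s)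
    Dii′≡ss′ = trans Dii′≡g (toℕ-difference s′ s)
    x≈ : toℕ (point i s) ≈ D i′ + toℕ s′
    x≈ = ≈-trans (toℕ-mod _) (diff≡⇒+≈ (d i′) s Dii′≡ss′)
    T  = chord k i s
    T′ = translate s′ k′ x≈ (toℕ-mod _) refl
    j  = M k i
    j′ = M k′ i′
    y≢z : point j s ≢ point j′ s′
    y≢z e with j ≟ᶠ j′
    ... | yes j≡j′ = s≢s′ (toℕ-≈-injective (+-cancelˡ (D j′)
                       (subst (λ u → D u + toℕ s ≈ D j′ + toℕ s′) j≡j′ (point-≡⇒≈ e))))
    ... | no j≢j′  = matched⇒≢ {k} refl (sym (proj₁ (differences-unique j≢j′ (di≢di′ ∘ cong d)
                       (trans (+≈⇒diff≡ (d j′) s (point-≡⇒≈ e)) (sym Dii′≡ss′)))))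

  colour-complete : ∀ a b → a ≢ b → ColoursMeet a b
  colour-complete a b a≢b with combine-surjective {t} a | combine-surjective {t} b
  ... | k , s , refl | k′ , s′ , refl with s ≟ᶠ s′
  ...   | yes refl = meet-same-shift s (λ { refl → a≢b refl })
  ...   | no s≢s′  = meet-other-shift k k′ s≢s′

  colouring : ProperCompleteColoring n J (t * n)
  colouring = record
    { col      = colour
    ; symm     = colour-symm
    ; surj     = colour-surjective
    ; proper   = colour-proper
    ; complete = colour-complete
    }

n*r≡t*n*[q+1] : ∀ q t → suc (q * q + q) * ((q + 1) * t) ≡ t * suc (q * q + q) * suc q
n*r≡t*n*[q+1] = solve-∀

q*r+t≡t*n : ∀ q t → q * ((q + 1) * t) + t ≡ t * suc (q * q + q)
q*r+t≡t*n = solve-∀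

colours-bound⇒≤t*n : ∀ q t k → k * suc q ≤ nOf q * ((q + 1) * t) ⊎ k ≤ q * ((q + 1) * t) → k ≤ t * nOf q
colours-bound⇒≤t*n q t k (inj₁ k[q+1]≤nr) =
  *-cancelʳ-≤ k (t * nOf q) (suc q) (≤-trans k[q+1]≤nr (≤-reflexive (n*r≡t*n*[q+1] q t)))
colours-bound⇒≤t*n q t k (inj₂ k≤qr) = ≤-trans k≤qr (≤-trans (m≤m+n _ t) (≤-reflexive (q*r+t≡t*n q t)))

module _ {n} .{{_ : NonZero n}} {J k} (C : ProperCompleteColoring n J k) where

  open ProperCompleteColoring C

  colours-meet : ∀ a b → ∃[ x ] ∃[ y ] ∃[ z ] (Adj n J x y × Adj n J x z × col x y ≡ a × col x z ≡ b)
  colours-meet a b with a ≟ᶠ b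
  ... | yes refl = let x , y , x∼y , e = surj a in x , y , y , x∼y , x∼y , e , e
  ... | no a≢b   = let x , y , z , x∼y , x∼z , _ , ea , eb = complete a b a≢b in x , y , z , x∼y , x∼z , ea , eb

theorem10 : (q t : ℕ) (J : ℕ → Bool) →
    q % 2 ≡ 1 → 1 ≤ t → t ≤ q →
    (∀ s → J s ≡ true → (1 ≤ s) × (s ≤ nOf q / 2)) →
    (∀ x → degree (nOf q) J x ≡ (q + 1) * t) →
    (d : Fin (suc q) → Fin (nOf q)) → IsDifferenceSet (nOf q) (suc q) d →
    (Σ (Fin t → Fin (suc q) → Fin (suc q)) λ M →
       (∀ k → IsPerfectMatching (suc q) (M k)) ×
       (∀ k l → k ≢ l → ∀ i → M k i ≢ M l i) ×
       (∀ i j → i ≢ j → ((J (len (nOf q) (toℕ (d i)) (toℕ (d j))) ≡ true) ⇔ (∃[ k ] M k i ≡ j)))) →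
    AchromaticIndexIs (nOf q) J (t * nOf q)
theorem10 q t J _ 1≤t _ _ regular d difference-set (M , perfect , disjoint , J-matched) =
  TranslateColouring.colouring J d difference-set M perfect disjoint J-matched (fromℕ< 1≤t) ,
  λ k C → colours-bound⇒≤t*n q t k
            (ColourCounting.colours-bound (adj? (nOf q) J) regular (ProperCompleteColoring.col C) (colours-meet C) q)
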